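{- Let $n\geq 2$ be finite and let $\mathfrak A\in SA_n$ be completely representable, with complete representation $f:\mathfrak A\to\wp(V)$. Then for every $\tau\in{}^nn$, $\sum\{s_\tau x:x\in\mathrm{At}\mathfrak A\}=1$ (the supremum exists and equals $1$).
   Context: Fix finite $n\geq 2$. $[i,j]$ is the transposition of $n$ swapping $i,j$; $[i/j]:n\to n$ maps $i$ to $j$ and is the identity elsewhere. An $SA_n$-type algebra is a Boolean algebra with unary operations $s^i_j,s_{ij}$ ($i\neq j<n$). For a word $t$ over these symbols define $\hat t\in{}^nn$: empty word $\mapsto Id_n$, $(s_{ij}t)^{\hat{}}=[i,j]\circ\hat t$, $(s^i_jt)^{\hat{}}=[i/j]\circ\hat t$. $\Sigma'_n$: Boolean axioms; each $s^i_j,s_{ij}$ preserves $\wedge$ and $-$; $t_1(x)=t_2(x)$ whenever $\hat t_1=\hat t_2$. $SA_n=\mathbf{Mod}(\Sigma'_n)$. For $\tau\in{}^nn$, $s_\tau x$ denotes $t(x)$ for any word with $\hat t=\tau$. $\mathrm{At}\mathfrak A$ is the set of atoms. $V\subseteq{}^nU$ is dipermutable if $s\in V$ implies $s\circ[i/j]\in V$ and $s\circ[i,j]\in V$; $\wp(V)=\langle\mathcal P(V),\cap,-,S^i_j,S_{ij}\rangle$ with complement relative to $V$, $S^i_j(X)=\{q\in V:q\circ[i/j]\in X\}$, $S_{ij}(X)=\{q\in V:q\circ[i,j]\in X\}$. A complete representation is an injective homomorphism $f:\mathfrak A\to\wp(V)$, $V$ dipermutable, with $f(\prod X)=\bigcap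 f[X]$ whenever $\prod X$ exists. -}

module Defs where

open import Level using (0ℓ)
open import Data.Nat using (ℕ)
open import Data.Fin using (Fin)
open import Data.Fin.Properties using (_≟_)
open import Data.List using (List; []; _∷_)
open import Data.Product using (_×_; ∃; Σ)
open import Data.Sum using (_⊎_)
open import Function using (_∘_; id)
open import Relation.Nullary using (¬_; yes; no)
open import Relation.Unary using (Pred; _∈_; _∉_; _⊆_; _≐_)
open import Relation.Binary.PropositionalEquality using (_≡_; _≢_; _≗_)
open import Algebra.Lattice.Bundles using (BooleanAlgebra)

[_/_] : ∀ {n} → Fin n → Fin n → Fin n → Fin n
[ i / j ] k with k ≟ i
... | yes _ = j
... | no  _ = k

[_,_] : ∀ {n} → Fin n → Fin n → Fin n → Fin n
[ i , j ] k with k ≟ i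
... | yes _ = j
... | no  _ with k ≟ j
...   | yes _ = i
...   | no  _ = k

data Letter (n : ℕ) : Set where
  subL : (i j : Fin n) → i ≢ j → Letter n
  swpL : (i j : Fin n) → i ≢ j → Letter n

Word : ℕ → Set
Word n = List (Letter n)

letterMap : ∀ {n} → Letter n → Fin n → Fin n
letterMap (subL i j _) = [ i / j ]
letterMap (swpL i j _) = [ i , j ]

hat : ∀ {n} → Word n → Fin n → Fin n
hat []      = id
hat (l ∷ t) = letterMap l ∘ hat t

applyWord : ∀ {n} {C : Set} →
            ((i j : Fin n) → i ≢ j → C → C) →
            ((i j : Fin n) → i ≢ j → C → C) →
            Word n → C → C
applyWord sub swp []                 x = x
applyWord sub swp (subL i j p ∷ t) x = sub i j p (applyWord sub swp t x)
applyWord sub swp (swpL i j p ∷ t) x = swp i j p (applyWord sub swp t x)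

record SA (n : ℕ) : Set₁ where
  field
    boolAlg : BooleanAlgebra 0ℓ 0ℓ
  open BooleanAlgebra boolAlg public renaming (¬_ to -_)
  field
    sub : (i j : Fin n) → i ≢ j → Carrier → Carrier
    swp : (i j : Fin n) → i ≢ j → Carrier → Carrier
    sub-cong : ∀ i j (p : i ≢ j) {x y} → x ≈ y → sub i j p x ≈ sub i j p y
    swp-cong : ∀ i j (p : i ≢ j) {x y} → x ≈ y → swp i j p x ≈ swp i j p y
    sub-∧ : ∀ i j (p : i ≢ j) x y → sub i j p (x ∧ y) ≈ sub i j p x ∧ sub i j p y
    swp-∧ : ∀ i j (p : i ≢ j) x y → swp i j p (x ∧ y) ≈ swp i j p x ∧ swp i j p y
    sub-¬ : ∀ i j (p : i ≢ j) x → sub i j p (- x) ≈ - (sub i j p x)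
    swp-¬ : ∀ i j (p : i ≢ j) x → swp i j p (- x) ≈ - (swp i j p x)
    words : ∀ (t₁ t₂ : Word n) → hat t₁ ≗ hat t₂ → ∀ x →
            applyWord sub swp t₁ x ≈ applyWord sub swp t₂ x

  ⟦_⟧ : Word n → Carrier → Carrier
  ⟦_⟧ = applyWord sub swp

  _≤_ : Carrier → Carrier → Set
  x ≤ y = (x ∧ y) ≈ x

  IsAtom : Pred Carrier 0ℓ
  IsAtom x = (¬ (x ≈ ⊥)) × (∀ y → y ≤ x → (y ≈ ⊥) ⊎ (y ≈ x))

  IsSup : Pred Carrier 0ℓ → Carrier → Set
  IsSup X σ = (∀ y → y ∈ X → y ≤ σ) × (∀ b → (∀ y → y ∈ X → y ≤ b) → σ ≤ b)

  IsInf : Pred Carrier 0ℓ → Carrier → Set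
  IsInf X m = (∀ y → y ∈ X → m ≤ y) × (∀ b → (∀ y → y ∈ X → b ≤ y) → b ≤ m)

Dipermutable : ∀ {n} {U : Set} → Pred (Fin n → U) 0ℓ → Set
Dipermutable {n} V = ∀ s → s ∈ V → ∀ (i j : Fin n) → i ≢ j →
  ((s ∘ [ i / j ]) ∈ V) × ((s ∘ [ i , j ]) ∈ V)

record CompleteRepresentation {n} (𝔄 : SA n) {U : Set}
         (V : Pred (Fin n → U) 0ℓ) (f : SA.Carrier 𝔄 → Pred (Fin n → U) 0ℓ)
         : Set₁ where
  open SA 𝔄
  field
    dipermutable : Dipermutable V
    into       : ∀ a → f a ⊆ V
    f-cong     : ∀ {a b} → a ≈ b → f a ≐ f b
    hom-∧      : ∀ a b → f (a ∧ b) ≐ (λ q → q ∈ f a × q ∈ f b)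
    hom-¬      : ∀ a → f (- a) ≐ (λ q → q ∈ V × q ∉ f a)
    hom-sub    : ∀ i j (p : i ≢ j) a →
                 f (sub i j p a) ≐ (λ q → q ∈ V × (q ∘ [ i / j ]) ∈ f a)
    hom-swp    : ∀ i j (p : i ≢ j) a →
                 f (swp i j p a) ≐ (λ q → q ∈ V × (q ∘ [ i , j ]) ∈ f a)
    injective  : ∀ {a b} → f a ≐ f b → a ≈ b
    -- complete: f(∏X) = ⋂ f[X] whenever ∏X exists (⋂ of the empty family is V)
    complete   : ∀ (X : Pred Carrier 0ℓ) m → IsInf X m →
                 f m ≐ (λ q → q ∈ V × (∀ a → a ∈ X → q ∈ f a))

CompletelyRepresentable : ∀ {n} → SA n → Set₁
CompletelyRepresentable {n} 𝔄 =
  Σ Set λ U → Σ (Pred (Fin n → U) 0ℓ) λ V →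
  Σ (SA.Carrier 𝔄 → Pred (Fin n → U) 0ℓ) λ f → CompleteRepresentation 𝔄 V f

module Submission where

-- Let f : 𝔄 → ℘(V) be a complete representation and t a word
-- with t̂ = τ.  By injectivity of f, an upper bound b of {s_τ x : x atom}
-- equals ⊤ as soon as f b ⊇ V = f ⊤; so it suffices that the sets f(s_τ x),
-- x an atom, cover V (lemma coverIsSup).  For q ∈ V, the point q ∘ τ again
-- lies in V (dipermutability), and q ∈ f(s_τ x) whenever q ∘ τ ∈ f x
-- (homomorphism, lemma wordImage).  Finally every point p ∈ V lies in f x
-- for some atom x (lemma atomAtPoint): the elements containing p have, by
-- the Boolean algebra laws, either a nonzero lower bound — which is then an
-- atom containing p — or infimum ⊥; in the latter case completeness of f
-- would put p into f ⊥ = ∅.  This last step is classical, whence the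
-- excluded-middle hypothesis.

open import Defs
open import Data.Nat using (ℕ; _≤_)
open import Data.Fin using (Fin)
open import Data.Product using (∃; _×_; _,_; proj₁; proj₂)
open import Data.Sum using (_⊎_; inj₁; inj₂)
open import Data.Empty using (⊥-elim)
open import Data.List using ([]; _∷_)
open import Function using (_∘_)
open import Relation.Nullary using (yes; no)
open import Relation.Unary using (Pred; _∈_; _∉_; _⊆_)
open import Relation.Binary.PropositionalEquality using (_≗_)
open import Axiom.ExcludedMiddle using (ExcludedMiddle)
open import Level using (0ℓ)
import Algebra.Lattice.Properties.BooleanAlgebra as BooleanAlgebraProperties
import Relation.Binary.Reasoning.Setoid as SetoidReasoning

module BooleanOrder {n : ℕ} (𝔄 : SA n) where
  open SA 𝔄 renaming (_≤_ to _≤ₐ_)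

  ≤-trans : ∀ {x y z} → x ≤ₐ y → y ≤ₐ z → x ≤ₐ z
  ≤-trans {x} {y} {z} x≤y y≤z = begin
    x ∧ z        ≈⟨ ∧-congʳ x≤y ⟨
    (x ∧ y) ∧ z  ≈⟨ ∧-assoc x y z ⟩
    x ∧ (y ∧ z)  ≈⟨ ∧-congˡ y≤z ⟩
    x ∧ y        ≈⟨ x≤y ⟩
    x            ∎
    where open SetoidReasoning setoid

  ≤-antisym : ∀ {x y} → x ≤ₐ y → y ≤ₐ x → x ≈ y
  ≤-antisym {x} {y} x≤y y≤x = trans (sym x≤y) (trans (∧-comm x y) y≤x)

  ≤-complement⇒⊥ : ∀ {x} → x ≤ₐ (- x) → x ≈ ⊥
  ≤-complement⇒⊥ {x} x≤-x = trans (sym x≤-x) (∧-complementʳ x)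

module Representation (em : ExcludedMiddle 0ℓ) {n : ℕ} (𝔄 : SA n)
  {U : Set} (V : Pred (Fin n → U) 0ℓ) (f : SA.Carrier 𝔄 → Pred (Fin n → U) 0ℓ)
  (R : CompleteRepresentation 𝔄 V f) where
  open SA 𝔄 renaming (_≤_ to _≤ₐ_)
  open CompleteRepresentation R
  open BooleanOrder 𝔄
  open BooleanAlgebraProperties boolAlg
    using (∧-zeroˡ; ∧-zeroʳ; ∧-identityˡ; ∧-identityʳ; ¬⊥≈⊤)

  -- f ⊥ = f (⊤ ∧ -⊤) is empty
  f⊥-empty : ∀ q → q ∉ f ⊥
  f⊥-empty q q∈f⊥ with proj₁ (hom-∧ ⊤ (- ⊤)) (proj₁ (f-cong (sym (∧-complementʳ ⊤))) q∈f⊥)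
  ... | q∈f⊤ , q∈f-⊤ = proj₂ (proj₁ (hom-¬ ⊤) q∈f-⊤) q∈f⊤

  -- f ⊤ = f (-⊥) is all of V
  V⊆f⊤ : V ⊆ f ⊤
  V⊆f⊤ {q} q∈V = proj₁ (f-cong ¬⊥≈⊤) (proj₂ (hom-¬ ⊥) (q∈V , f⊥-empty q))

  f-mono : ∀ {a c} → a ≤ₐ c → f a ⊆ f c
  f-mono {a} {c} a≤c q∈fa = proj₂ (proj₁ (hom-∧ a c) (proj₂ (f-cong a≤c) q∈fa))

  f-complement : ∀ {a q} → q ∈ V → q ∉ f a → q ∈ f (- a)
  f-complement {a} q∈V q∉fa = proj₂ (hom-¬ a) (q∈V , q∉fa)

  -- By injectivity, ⊤ is the supremum of any X whose images cover V.
  coverIsSup : (X : Pred Carrier 0ℓ) →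
               (∀ {q} → q ∈ V → ∃ λ y → y ∈ X × q ∈ f y) → IsSup X ⊤
  coverIsSup X cover = (λ y _ → ∧-identityʳ y) , leastUpperBound
    where
    leastUpperBound : ∀ b → (∀ y → y ∈ X → y ≤ₐ b) → ⊤ ≤ₐ b
    leastUpperBound b ub = trans (∧-identityˡ b) (injective (fb⊆f⊤ , f⊤⊆fb))
      where
      fb⊆f⊤ : f b ⊆ f ⊤
      fb⊆f⊤ q∈fb = V⊆f⊤ (into b q∈fb)
      f⊤⊆fb : f ⊤ ⊆ f b
      f⊤⊆fb q∈f⊤ with cover (into ⊤ q∈f⊤)
      ... | y , y∈X , q∈fy = f-mono (ub y y∈X) q∈fy

  module _ {p : Fin n → U} (p∈V : p ∈ V) where

    Containing : Pred Carrier 0ℓ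
    Containing c = p ∈ f c

    lowerBound⊥OrAtom : ∀ b → (∀ c → c ∈ Containing → b ≤ₐ c) →
                        b ≈ ⊥ ⊎ (IsAtom b × p ∈ f b)
    lowerBound⊥OrAtom b lb with em {b ≈ ⊥}
    ... | yes b≈⊥ = inj₁ b≈⊥
    ... | no  b≉⊥ = inj₂ ((b≉⊥ , below) , p∈fb)
      where
      belowComplement : ∀ {c} → p ∉ f c → b ≤ₐ (- c)
      belowComplement p∉fc = lb _ (f-complement p∈V p∉fc)

      p∈fb : p ∈ f b
      p∈fb with em {p ∈ f b}
      ... | yes p∈fb = p∈fb
      ... | no  p∉fb = ⊥-elim (b≉⊥ (≤-complement⇒⊥ (belowComplement p∉fb)))

      below : ∀ y → y ≤ₐ b → y ≈ ⊥ ⊎ y ≈ b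
      below y y≤b with em {p ∈ f y}
      ... | yes p∈fy = inj₂ (≤-antisym y≤b (lb y p∈fy))
      ... | no  p∉fy = inj₁ (≤-complement⇒⊥ (≤-trans y≤b (belowComplement p∉fy)))

    -- Classically, if no atom contained p then ⊥ = ∏ Containing, and
    -- completeness would put p into f ⊥ = ∅.
    atomAtPoint : ∃ λ x → IsAtom x × p ∈ f x
    atomAtPoint with em {∃ λ x → IsAtom x × p ∈ f x}
    ... | yes atom = atom
    ... | no  noAtom = ⊥-elim (f⊥-empty p p∈f⊥)
      where
      lowerBound⊥ : ∀ b → (∀ c → c ∈ Containing → b ≤ₐ c) → b ≈ ⊥
      lowerBound⊥ b lb with lowerBound⊥OrAtom b lb
      ... | inj₁ b≈⊥ = b≈⊥
      ... | inj₂ (atom , p∈fb) = ⊥-elim (noAtom (b , atom , p∈fb))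

      ⊥IsInf : IsInf Containing ⊥
      ⊥IsInf = (λ c _ → ∧-zeroˡ c) , λ b lb → trans (∧-zeroʳ b) (sym (lowerBound⊥ b lb))

      p∈f⊥ : p ∈ f ⊥
      p∈f⊥ = proj₂ (complete Containing ⊥ ⊥IsInf) (p∈V , λ _ p∈fc → p∈fc)

  precompose : ∀ (t : Word n) {q} → q ∈ V → (q ∘ hat t) ∈ V
  precompose []               q∈V = q∈V
  precompose (subL i j p ∷ t) q∈V = precompose t (proj₁ (dipermutable _ q∈V i j p))
  precompose (swpL i j p ∷ t) q∈V = precompose t (proj₂ (dipermutable _ q∈V i j p))

  wordImage : ∀ (t : Word n) x {q} → q ∈ V → (q ∘ hat t) ∈ f x → q ∈ f (⟦ t ⟧ x)
  wordImage []               x q∈V q∈fx = q∈fx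
  wordImage (subL i j p ∷ t) x q∈V h =
    proj₂ (hom-sub i j p (⟦ t ⟧ x)) (q∈V , wordImage t x (proj₁ (dipermutable _ q∈V i j p)) h)
  wordImage (swpL i j p ∷ t) x q∈V h =
    proj₂ (hom-swp i j p (⟦ t ⟧ x)) (q∈V , wordImage t x (proj₂ (dipermutable _ q∈V i j p)) h)

  wordAtomsSup : ∀ (t : Word n) → IsSup (λ y → ∃ λ x → IsAtom x × y ≈ ⟦ t ⟧ x) ⊤
  wordAtomsSup t = coverIsSup _ cover
    where
    cover : ∀ {q} → q ∈ V → ∃ λ y → (∃ λ x → IsAtom x × y ≈ ⟦ t ⟧ x) × q ∈ f y
    cover q∈V with atomAtPoint (precompose t q∈V)
    ... | x , atom , q∘t∈fx = ⟦ t ⟧ x , (x , atom , refl) , wordImage t x q∈V q∘t∈fx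

mainTheorem11 : ExcludedMiddle 0ℓ →
    ∀ (n : ℕ) → 2 ≤ n → (𝔄 : SA n) →
    {U : Set} (V : Pred (Fin n → U) 0ℓ) (f : SA.Carrier 𝔄 → Pred (Fin n → U) 0ℓ) →
    CompleteRepresentation 𝔄 V f →
    ∀ (τ : Fin n → Fin n) (t : Word n) → hat t ≗ τ →
    SA.IsSup 𝔄 (λ y → ∃ λ x → SA.IsAtom 𝔄 x × SA._≈_ 𝔄 y (SA.⟦_⟧ 𝔄 t x)) (SA.⊤ 𝔄)
mainTheorem11 em n _ 𝔄 V f R τ t _ = Representation.wordAtomsSup em 𝔄 V f R t
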